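{- Let $\mathcal{A}=(Q,\delta,I,\Gamma,p,\mathit{Acc})$ be an $\mathrm{Inf}$-TELA with $n=|Q|$ and let $\mathcal{B}$ be the Büchi automaton constructed from $\mathcal{A}$ as described in the context. Let $k=|\mathrm{Min}|$. Then the number of states of $\mathcal{B}$ is in $O(k^n\cdot\mathrm{tight}(n+1))$, which (using the known estimate $\mathrm{tight}(n)\approx(0.76n)^n$) is $O(n(0.76nk)^n)$.
   Context: TELA: $\mathcal{A}=(Q,\delta,I,\Gamma,p,\mathit{Acc})$ with finite states $Q$, transitions $\delta\subseteq Q\times\Sigma\times Q$, initial states $I$, colours $\Gamma=\{0,\dots,k'-1\}$, colouring $p:\delta\to2^\Gamma$, and acceptance formula $\mathit{Acc}$ built from $\mathit{true},\mathit{false},\mathrm{Inf}(c),\mathrm{Fin}(c)$ by $\wedge,\vee$. An $\mathrm{Inf}$-TELA has no $\mathrm{Fin}$ atoms in $\mathit{Acc}$. $\delta(S,a)=\{q'\mid\exists q\in S:(q,a,q')\in\delta\}$. $\overline{\mathit{Acc}}$: the negation of $\mathit{Acc}$ in negation normal form with each $\neg\mathrm{Inf}(c)$ written as the propositional variable $c$; a model is $M\subseteq\Gamma$ satisfying it; $\mathrm{Min}$ is the (assumed nonempty) set of $\subseteq$-minimal models and $\mathrm{lex}$ its lexicographically smallest element. $\lfloor k\rfloor_{\mathrm{even}}$ is the largest even number $\le k$. $\mathrm{tight}(n)$ denotes the number of functions $f:\{1,\dots,n\}\to\omega$ whose maximum $r$ is odd and whose image contains $\{1,3,\dots,r\}$.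 Level ranking $f:Q\to\{0,\dots,2n\}$, $\mathrm{rank}(f)=\max f$; level model $\mu:Q\to\mathrm{Min}$, consistent w.r.t. $f$ if $\mu(q)=\mathrm{lex}$ whenever $f(q)$ is even; $f$ is $(S,\mu)$-tight if $\mathrm{rank}(f)=r$ is odd, $f(S)\supseteq\{1,3,\dots,r\}$, $f(Q\setminus S)=\{0\}$ and $\mu$ is consistent w.r.t. $f$; $\mathcal{T}$ is the set of $f$ that are $(Q,\mu)$-tight for some $\mu$. $(f,\mu)\to_a(f',\mu')$ iff $\mu,\mu'$ consistent w.r.t. $f,f'$ and for all $q$, $q'\in\delta(q,a)$: $f'(q')\le f(q)$; if $p((q,a,q'))\cap\mu(q)\ne\emptyset$ then $f'(q')\le\lfloor f(q)\rfloor_{\mathrm{even}}$; if $\mu'(q')\neq\mu(q)$ then $f'(q')\le\lfloor f(q)\rfloor_{\mathrm{even}}$. $\mathcal{B}=(Q',\delta',I',F')$ is the transition-based Büchi automaton with $Q'=2^Q\cup Q_2$, where $Q_2$ is the set of tuples $(S,O,f,i,\mu)$ with $S,O\subseteq Q$, $f\in\mathcal{T}$, $i\in\{0,2,\dots,2n-2\}$, $\mu$ a level model, $f$ $(S,\mu)$-tight and $O\subseteq S\cap f^{ -1}(i)$; $I'=\{I\}$; transitions $S\xrightarrow{a}\delta(S,a)$ for $S\subseteq Q$, $S\xrightarrow{a}(\delta(S,a),\emptyset,f,0,\mu)\in Q_2$, and $(S,O,f,i,\mu)\xrightarrow{a}(S',O',f',i',\mu')$ in $Q_2$ iff $S'=\delta(S,a)$,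 $(f,\mu)\to_a(f',\mu')$, $\mathrm{rank}(f)=\mathrm{rank}(f')$, and either ($O=\emptyset$, $i'=(i+2)\bmod(\mathrm{rank}(f')+1)$, $O'=f'^{ -1}(i')$) or ($O\neq\emptyset$, $i'=i$, $O'=\delta(O,a)\cap f'^{ -1}(i)$); accepting transitions are $\emptyset\xrightarrow{a}\emptyset$ and the transitions between elements of $Q_2$ whose source has $O=\emptyset$. -}

module Defs where

open import Data.Nat using (ℕ; zero; suc; _+_; _*_; _≤_; _⊔_; ⌊_/2⌋)
open import Data.Fin using (Fin)
open import Data.Fin.Subset using (Subset; Side; inside; outside; _∈_; _∉_; _⊆_; Nonempty; Empty; ⊤)
open import Data.Vec using (Vec; []; _∷_; lookup; foldr)
open import Data.Product using (Σ; ∃; ∃-syntax; _×_; _,_)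
open import Data.Sum using (_⊎_; inj₁; inj₂)
open import Data.Empty using (⊥)
open import Data.Unit using () renaming (⊤ to Unit)
open import Relation.Binary.PropositionalEquality using (_≡_)
open import Relation.Nullary using (¬_)

Even : ℕ → Set
Even r = ∃[ j ] r ≡ 2 * j

Odd : ℕ → Set
Odd r = ∃[ j ] r ≡ 1 + 2 * j

⌊_⌋even : ℕ → ℕ
⌊ k ⌋even = 2 * ⌊ k /2⌋

maxV : ∀ {n} → Vec ℕ n → ℕ
maxV = foldr _ _⊔_ 0

data AccF (k' : ℕ) : Set where
  tt ff : AccF k'
  Inf Fin' : Fin k' → AccF k'
  _∧'_ _∨'_ : AccF k' → AccF k' → AccF k'

InfOnly : ∀ {k'} → AccF k' → Set
InfOnly tt = Unit
InfOnly ff = Unit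
InfOnly (Inf c) = Unit
InfOnly (Fin' c) = ⊥
InfOnly (φ ∧' ψ) = InfOnly φ × InfOnly ψ
InfOnly (φ ∨' ψ) = InfOnly φ × InfOnly ψ

data PForm (k' : ℕ) : Set where
  ptrue pfalse : PForm k'
  var : Fin k' → PForm k'
  _∧p_ _∨p_ : PForm k' → PForm k' → PForm k'

-- negation normal form of ¬Acc, with ¬Inf(c) written as variable c
negAcc : ∀ {k'} (φ : AccF k') → InfOnly φ → PForm k'
negAcc tt _ = pfalse
negAcc ff _ = ptrue
negAcc (Inf c) _ = var c
negAcc (Fin' c) ()
negAcc (φ ∧' ψ) (a , b) = negAcc φ a ∨p negAcc ψ b
negAcc (φ ∨' ψ) (a , b) = negAcc φ a ∧p negAcc ψ b

_⊨_ : ∀ {k'} → Subset k' → PForm k' → Set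
M ⊨ ptrue = Unit
M ⊨ pfalse = ⊥
M ⊨ var c = c ∈ M
M ⊨ (φ ∧p ψ) = (M ⊨ φ) × (M ⊨ ψ)
M ⊨ (φ ∨p ψ) = (M ⊨ φ) ⊎ (M ⊨ ψ)

IsMin : ∀ {k'} → PForm k' → Subset k' → Set
IsMin φ M = (M ⊨ φ) × (∀ M' → M' ⊆ M → M' ⊨ φ → M' ≡ M)

-- strict lexicographic order on subsets of Fin k', viewed as increasing
-- sequences of colours (a proper prefix is smaller)
LexLt : ∀ {k'} → Subset k' → Subset k' → Set
LexLt [] [] = ⊥
LexLt (inside ∷ a) (inside ∷ b) = LexLt a b
LexLt (outside ∷ a) (outside ∷ b) = LexLt a b
LexLt (inside ∷ a) (outside ∷ b) = Nonempty b
LexLt (outside ∷ a) (inside ∷ b) = Empty a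

IsLex : ∀ {k'} → PForm k' → Subset k' → Set
IsLex φ M = IsMin φ M × (∀ M' → IsMin φ M' → M' ≡ M ⊎ LexLt M M')

-- TELA  A = (Q, δ, I, Γ, p, Acc) with Q = Fin n, Σ = Fin m, Γ = Fin k'

record TELA : Set₁ where
  field
    n m k' : ℕ
    δ   : Fin n → Fin m → Fin n → Set
    I   : Subset n
    p   : Fin n → Fin m → Fin n → Subset k'
    Acc : AccF k'

IsInfTELA : TELA → Set
IsInfTELA A = InfOnly (TELA.Acc A)

-- Tight functions: tight(n) is the cardinality of TightFun n

IsTightFun : ∀ {n} → Vec ℕ n → Set
IsTightFun {n} v = Odd (maxV v) ×
  (∀ j → Odd j → j ≤ maxV v → ∃[ x ] lookup v x ≡ j)

module Construction (A : TELA) (inf : IsInfTELA A) where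
  open TELA A

  negφ : PForm k'
  negφ = negAcc Acc inf

  Level : Set
  Level = Vec ℕ n

  LevelM : Set
  LevelM = Vec (Subset k') n

  IsLevelRanking : Level → Set
  IsLevelRanking f = ∀ q → lookup f q ≤ 2 * n

  IsLevelModel : LevelM → Set
  IsLevelModel μ = ∀ q → IsMin negφ (lookup μ q)

  rank : Level → ℕ
  rank = maxV

  Consistent : Level → LevelM → Set
  Consistent f μ = ∀ q → Even (lookup f q) → IsLex negφ (lookup μ q)

  Tight : Subset n → Level → LevelM → Set
  Tight S f μ = IsLevelRanking f × IsLevelModel μ ×
    Odd (rank f) ×
    (∀ j → Odd j → j ≤ rank f → ∃[ q ] (q ∈ S × lookup f q ≡ j)) ×
    (∀ q → q ∉ S → lookup f q ≡ 0) ×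
    Consistent f μ

  InT : Level → Set
  InT f = ∃[ μ ] Tight ⊤ f μ

  post : Subset n → Fin m → Fin n → Set
  post S a q' = ∃[ q ] (q ∈ S × δ q a q')

  IsPost : Subset n → Fin m → Subset n → Set
  IsPost S a S' = ∀ q' → (q' ∈ S' → post S a q') × (post S a q' → q' ∈ S')

  Step : Level → LevelM → Fin m → Level → LevelM → Set
  Step f μ a f' μ' = Consistent f μ × Consistent f' μ' ×
    (∀ q q' → δ q a q' →
        (lookup f' q' ≤ lookup f q) ×
        (Nonempty (p q a q' Data.Fin.Subset.∩ lookup μ q) →
            lookup f' q' ≤ ⌊ lookup f q ⌋even) ×
        (¬ (lookup μ' q' ≡ lookup μ q) → lookup f' q' ≤ ⌊ lookup f q ⌋even))

  Q2raw : Set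
  Q2raw = Subset n × Subset n × Level × ℕ × LevelM

  InQ2 : Q2raw → Set
  InQ2 (S , O , f , i , μ) =
    InT f × (Even i × i + 2 ≤ 2 * n) × IsLevelModel μ × Tight S f μ ×
    (∀ q → q ∈ O → q ∈ S × lookup f q ≡ i)

  Qraw : Set
  Qraw = Subset n ⊎ Q2raw

  IsState : Qraw → Set
  IsState (inj₁ S) = Unit
  IsState (inj₂ t) = InQ2 t

  initial : Qraw
  initial = inj₁ I

  Trans : Qraw → Fin m → Qraw → Set
  Trans (inj₁ S) a (inj₁ S') = IsPost S a S'
  Trans (inj₁ S) a (inj₂ (S' , O' , f' , i' , μ')) =
    InQ2 (S' , O' , f' , i' , μ') × IsPost S a S' × Empty O' × i' ≡ 0
  Trans (inj₂ t) a (inj₁ S') = ⊥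
  Trans (inj₂ (S , O , f , i , μ)) a (inj₂ (S' , O' , f' , i' , μ')) =
    InQ2 (S , O , f , i , μ) × InQ2 (S' , O' , f' , i' , μ') ×
    IsPost S a S' × Step f μ a f' μ' × rank f ≡ rank f' ×
    ((Empty O × i' ≡ (i + 2) Data.Nat.% suc (rank f') ×
        (∀ q → (q ∈ O' → lookup f' q ≡ i') × (lookup f' q ≡ i' → q ∈ O')))
     ⊎ (Nonempty O × i' ≡ i ×
        (∀ q → (q ∈ O' → post O a q × lookup f' q ≡ i)
             × (post O a q × lookup f' q ≡ i → q ∈ O'))))

  Accepting : Qraw → Fin m → Qraw → Set
  Accepting (inj₁ S) a (inj₁ S') = Empty S × Empty S'
  Accepting (inj₁ S) a (inj₂ _) = ⊥
  Accepting (inj₂ _) a (inj₁ _) = ⊥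
  Accepting (inj₂ (S , O , f , i , μ)) a (inj₂ t') =
    Trans (inj₂ (S , O , f , i , μ)) a (inj₂ t') × Empty O

-- |X| ≤ |Y| for subsets X ⊆ A, Y ⊆ B given by predicates:
-- an injection from {x | P x} into {y | R y}

_≼_ : ∀ {A B : Set} → (A → Set) → (B → Set) → Set
_≼_ {A} {B} P R = Σ (A → B) λ g →
  (∀ x → P x → R (g x)) × (∀ x y → P x → P y → g x ≡ g y → x ≡ y)

-- The bound C · k^n · tight(n+1), with k = |Min|, realised as the set
-- Fin C × (level models Q → Min) × (tight functions {1..n+1} → ω),
-- whose cardinality is exactly C · |Min|^n · tight(n+1).
module Bound (A : TELA) (inf : IsInfTELA A) (C : ℕ) where
  open TELA A
  open Construction A inf

  BoundCarrier : Set
  BoundCarrier = Fin C × LevelM × Vec ℕ (suc n)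

  InBound : BoundCarrier → Set
  InBound (c , μ , w) = IsLevelModel μ × IsTightFun w

MinNonempty : (A : TELA) → IsInfTELA A → Set
MinNonempty A inf = ∃[ M ] IsMin (negAcc (TELA.Acc A) inf) M

-- Each state of B is sent injectively to a triple (tag, μ, w) with tag < 3, μ its
-- level model (a constant one for subset states) and w a tight function on n + 1
-- points. For a state (S, O, f, i, μ) of rank r, w keeps f on S and sends Q ∖ S to
-- r + 1; the rest of the data is recorded by raising some positions to r + 2 and
-- saving their common old value in the extra (n+1)-st slot: the states of O (old
-- value i) when O ≠ ∅, and otherwise the single state of index i/2. Then w has odd
-- maximum r + 2 and still hits every odd value below it, and S, O, f, i can all be
-- read back from the tag and w. A subset state S becomes its indicator function,
-- extended by a 1.
module Submission where

open import Defs
open import Data.Nat using (ℕ)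
open import Data.Product using (∃-syntax)

open import Data.Bool using (Bool; true; false; if_then_else_)
open import Data.Nat using (zero; suc; _*_; _+_; _∸_; _≤_; _<_; z≤n; s≤s; ⌊_/2⌋; _≟_)
open import Data.Nat.Properties
open import Data.Fin using (Fin; zero; suc; toℕ; fromℕ<)
open import Data.Fin.Properties using (any?; toℕ-fromℕ<; toℕ-injective)
open import Data.Fin.Subset using (Subset; Side; inside; outside; _∈_; _∉_; Nonempty)
  renaming (⊥ to ∅)
open import Data.Fin.Subset.Properties using (nonempty?; Empty-unique)
open import Data.Vec using (Vec; []; _∷_; lookup; tabulate; replicate)
open import Data.Vec.Properties
  using (lookup∘tabulate; tabulate∘lookup; tabulate-cong; lookup-replicate; []=⇒lookup; lookup⇒[]=)
open import Data.Product using (_×_; _,_; proj₁; proj₂)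
open import Data.Sum using (_⊎_; inj₁; inj₂)
open import Function using (_∘_)
open import Relation.Nullary using (¬_; Dec; yes; no; does; contradiction)
open import Relation.Nullary.Decidable using (dec-true; dec-false)
open import Relation.Binary.PropositionalEquality
  using (_≡_; refl; sym; trans; cong; cong₂; subst; module ≡-Reasoning)

Odd⇒¬Even : ∀ {x} → Odd x → ¬ Even x
Odd⇒¬Even (j , refl) (k , e) = even≢odd k j (sym e)

Odd⇒Odd-2+ : ∀ {r} → Odd r → Odd (suc (suc r))
Odd⇒Odd-2+ (j , refl) = suc j , cong suc (sym (*-suc 2 j))

Odd⇒¬Odd-1+ : ∀ {r} → Odd r → ¬ Odd (suc r)
Odd⇒¬Odd-1+ (j , refl) o = Odd⇒¬Even o (suc j , sym (*-suc 2 j))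

⌊2*n/2⌋≡n : ∀ n → ⌊ 2 * n /2⌋ ≡ n
⌊2*n/2⌋≡n n = trans (cong (λ m → ⌊ n + m /2⌋) (+-identityʳ n)) (sym (n≡⌊n+n/2⌋ n))

Even⇒≡2*⌊/2⌋ : ∀ {i} → Even i → i ≡ 2 * ⌊ i /2⌋
Even⇒≡2*⌊/2⌋ (j , refl) = cong (2 *_) (sym (⌊2*n/2⌋≡n j))

Even⇒⌊/2⌋< : ∀ {i n} → Even i → i + 2 ≤ 2 * n → ⌊ i /2⌋ < n
Even⇒⌊/2⌋< {n = n} (j , refl) i+2≤2n rewrite ⌊2*n/2⌋≡n j =
  *-cancelˡ-≤ 2 (subst (_≤ 2 * n) (trans (+-comm (2 * j) 2) (sym (*-suc 2 j))) i+2≤2n)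

Odd-<-2+ : ∀ {r j} → Odd r → Odd j → j < suc (suc r) → j ≤ r
Odd-<-2+ odd-r odd-j (s≤s j≤1+r) with m≤n⇒m<n∨m≡n j≤1+r
... | inj₁ (s≤s j≤r) = j≤r
... | inj₂ refl      = contradiction odd-j (Odd⇒¬Odd-1+ odd-r)

-- Tight functions

lookup≤maxV : ∀ {n} (v : Vec ℕ n) q → lookup v q ≤ maxV v
lookup≤maxV (x ∷ v) zero    = m≤m⊔n x (maxV v)
lookup≤maxV (x ∷ v) (suc q) = ≤-trans (lookup≤maxV v q) (m≤n⊔m x (maxV v))

maxV≤ : ∀ {n R} (v : Vec ℕ n) → (∀ q → lookup v q ≤ R) → maxV v ≤ R
maxV≤ []      _ = z≤n
maxV≤ (x ∷ v) h = ⊔-lub (h zero) (maxV≤ v (h ∘ suc))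

maxV-tabulate : ∀ {m R} (h : Fin m → ℕ) → (∀ x → h x ≤ R) → ∃[ x ] h x ≡ R →
                maxV (tabulate h) ≡ R
maxV-tabulate h h≤R (x , hx≡R) = ≤-antisym
  (maxV≤ (tabulate h) (λ y → subst (_≤ _) (sym (lookup∘tabulate h y)) (h≤R y)))
  (subst (_≤ maxV (tabulate h)) (trans (lookup∘tabulate h x) hx≡R) (lookup≤maxV (tabulate h) x))

tabulate-isTightFun : ∀ {m R} (h : Fin m → ℕ) → Odd R → (∀ x → h x ≤ R) →
                      (∀ j → Odd j → j ≤ R → ∃[ x ] h x ≡ j) → IsTightFun (tabulate h)
tabulate-isTightFun {R = R} h odd-R h≤R covers =
  subst Odd (sym max≡R) odd-R ,
  λ j odd-j j≤ → hit (covers j odd-j (subst (j ≤_) max≡R j≤))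
  where
  max≡R : maxV (tabulate h) ≡ R
  max≡R = maxV-tabulate h h≤R (covers R odd-R ≤-refl)
  hit : ∀ {j} → ∃[ x ] h x ≡ j → ∃[ x ] lookup (tabulate h) x ≡ j
  hit (x , hx≡j) = x , trans (lookup∘tabulate h x) hx≡j

-- Raising marked positions to a top value

does≡true⇒ : ∀ {P : Set} (P? : Dec P) → does P? ≡ true → P
does≡true⇒ (yes p) _ = p

restore : ℕ → ℕ → ℕ → ℕ
restore m x v = if does (v ≟ m) then x else v

restore-top : ∀ m x → restore m x m ≡ x
restore-top m x rewrite dec-true (m ≟ m) refl = refl

restore-< : ∀ {m v} x → v < m → restore m x v ≡ v
restore-< {m} {v} x v<m rewrite dec-false (v ≟ m) (<⇒≢ v<m) = refl

module _ {n : ℕ} where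

  marking : (Fin n → ℕ) → (Fin n → Bool) → ℕ → ℕ → Fin (suc n) → ℕ
  marking e P x m zero    = x
  marking e P x m (suc q) = if P q then m else e q

  markCode : (Fin n → ℕ) → (Fin n → Bool) → ℕ → ℕ → Vec ℕ (suc n)
  markCode e P x m = tabulate (marking e P x m)

  record IsMarking (e : Fin n → ℕ) (P : Fin n → Bool) (x m : ℕ) : Set where
    field
      below  : ∀ q → e q < m
      keeps  : ∀ q → P q ≡ true → e q ≡ x
      marked : ∃[ q ] P q ≡ true

  unmark : Vec ℕ (suc n) → Fin n → ℕ
  unmark w q = restore (maxV w) (lookup w zero) (lookup w (suc q))

  markedPositions : Vec ℕ (suc n) → Fin n → Bool
  markedPositions w q = does (lookup w (suc q) ≟ maxV w)

  markIndex : Vec ℕ (suc n) → ℕ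
  markIndex w with any? (λ q → lookup w (suc q) ≟ maxV w)
  ... | yes (q , _) = toℕ q
  ... | no _        = 0

  module Marking {e : Fin n → ℕ} {P : Fin n → Bool} {x m : ℕ} (M : IsMarking e P x m) where
    open IsMarking M

    marking-marked : ∀ {q} → P q ≡ true → marking e P x m (suc q) ≡ m
    marking-marked {q} Pq = cong (λ b → if b then m else e q) Pq

    marking-unmarked : ∀ {q} → P q ≡ false → marking e P x m (suc q) ≡ e q
    marking-unmarked {q} Pq = cong (λ b → if b then m else e q) Pq

    marking≤ : ∀ y → marking e P x m y ≤ m
    marking≤ zero    = subst (_≤ m) (keeps _ (proj₂ marked)) (<⇒≤ (below _))
    marking≤ (suc q) with P q
    ... | true  = ≤-refl
    ... | false = <⇒≤ (below q)

    maxV-markCode : maxV (markCode e P x m) ≡ m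
    maxV-markCode = maxV-tabulate _ marking≤ (suc _ , marking-marked (proj₂ marked))

    markCode-isTightFun : Odd m → (∀ j → Odd j → j < m → ∃[ q ] e q ≡ j) →
                          IsTightFun (markCode e P x m)
    markCode-isTightFun odd-m covers = tabulate-isTightFun _ odd-m marking≤ covers′
      where
      covers′ : ∀ j → Odd j → j ≤ m → ∃[ y ] marking e P x m y ≡ j
      covers′ j odd-j j≤m with m≤n⇒m<n∨m≡n j≤m
      ... | inj₂ refl = suc _ , marking-marked (proj₂ marked)
      ... | inj₁ j<m with covers j odd-j j<m
      ...   | q , eq≡j with P q in Pq
      ...     | true  = zero , trans (sym (keeps q Pq)) eq≡j
      ...     | false = suc q , trans (marking-unmarked Pq) eq≡j

    marking≡top⇒marked : ∀ q → marking e P x m (suc q) ≡ m → P q ≡ true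
    marking≡top⇒marked q eq with P q
    ... | true  = refl
    ... | false = contradiction eq (<⇒≢ (below q))

    unmark-markCode : ∀ q → unmark (markCode e P x m) q ≡ e q
    unmark-markCode q rewrite maxV-markCode | lookup∘tabulate (marking e P x m) (suc q) with P q in Pq
    ... | true  = trans (restore-top m x) (sym (keeps q Pq))
    ... | false = restore-< x (below q)

    markedPositions-markCode : ∀ q → markedPositions (markCode e P x m) q ≡ P q
    markedPositions-markCode q rewrite maxV-markCode | lookup∘tabulate (marking e P x m) (suc q) with P q
    ... | true  = dec-true (m ≟ m) refl
    ... | false = dec-false (e q ≟ m) (<⇒≢ (below q))

    markIndex-markCode : ∀ {t} → (∀ q → P q ≡ true → q ≡ t) → markIndex (markCode e P x m) ≡ toℕ t
    markIndex-markCode {t} unique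
      with any? (λ q → lookup (markCode e P x m) (suc q) ≟ maxV (markCode e P x m))
    ... | yes (q , eq) = cong toℕ (unique q (marking≡top⇒marked q top))
      where
      top : marking e P x m (suc q) ≡ m
      top = trans (sym (lookup∘tabulate (marking e P x m) (suc q))) (trans eq maxV-markCode)
    ... | no none = contradiction (q , reachesTop) none
      where
      q = proj₁ marked
      reachesTop : lookup (markCode e P x m) (suc q) ≡ maxV (markCode e P x m)
      reachesTop = trans (lookup∘tabulate (marking e P x m) (suc q))
                         (trans (marking-marked (proj₂ marked)) (sym maxV-markCode))

-- Encoding a function that is tight on a subset

tabulate-≗-lookup : ∀ {A : Set} {n} {g : Fin n → A} (v : Vec A n) →
                    (∀ q → g q ≡ lookup v q) → tabulate g ≡ v
tabulate-≗-lookup v g≗v = trans (tabulate-cong g≗v) (tabulate∘lookup v)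

lookupOr : ∀ {A : Set} {n} → A → Vec A n → ℕ → A
lookupOr a []      _       = a
lookupOr a (x ∷ v) zero    = x
lookupOr a (x ∷ v) (suc k) = lookupOr a v k

lookupOr-toℕ : ∀ {A : Set} {n} (a : A) (v : Vec A n) q → lookupOr a v (toℕ q) ≡ lookup v q
lookupOr-toℕ a (x ∷ v) zero    = refl
lookupOr-toℕ a (x ∷ v) (suc q) = lookupOr-toℕ a v q

level : ℕ → Side → ℕ → ℕ
level r inside  y = y
level r outside _ = suc r

unlevel : ℕ → ℕ → Side × ℕ
unlevel r v with v ≟ suc r
... | yes _ = outside , 0
... | no _  = inside , v

unlevel-level : ∀ {r y} s → y ≤ r → (s ≡ outside → y ≡ 0) → unlevel r (level r s y) ≡ (s , y)
unlevel-level {r} {y} inside y≤r _ with y ≟ suc r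
... | yes y≡1+r = contradiction y≡1+r (<⇒≢ (s≤s y≤r))
... | no _      = refl
unlevel-level {r} outside _ y≡0 with suc r ≟ suc r
... | yes _      = cong (outside ,_) (sym (y≡0 refl))
... | no 1+r≢1+r = contradiction refl 1+r≢1+r

module _ {n : ℕ} where

  record IsTightOn (S : Subset n) (f : Vec ℕ n) : Set where
    field
      rank-odd : Odd (maxV f)
      covered  : ∀ j → Odd j → j ≤ maxV f → ∃[ q ] (q ∈ S × lookup f q ≡ j)
      vanishes : ∀ q → q ∉ S → lookup f q ≡ 0

  levels : Subset n → Vec ℕ n → Fin n → ℕ
  levels S f q = level (maxV f) (lookup S q) (lookup f q)

  levelCode : Subset n → Vec ℕ n → (Fin n → Bool) → ℕ → Vec ℕ (suc n)
  levelCode S f P x = markCode (levels S f) P x (suc (suc (maxV f)))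

  decodeLevels : Vec ℕ (suc n) → Subset n × Vec ℕ n
  decodeLevels w = tabulate (proj₁ ∘ decoded) , tabulate (proj₂ ∘ decoded)
    where
    decoded : Fin n → Side × ℕ
    decoded q = unlevel (maxV w ∸ 2) (unmark w q)

  obligationCode : Subset n → Subset n → Vec ℕ n → ℕ → Vec ℕ (suc n)
  obligationCode S O f i = levelCode S f (lookup O) i

  isMarkOf : ℕ → Fin n → Bool
  isMarkOf d q = does (toℕ q ≟ d)

  isMarkOf⇒≡ : ∀ {d} q → isMarkOf d q ≡ true → toℕ q ≡ d
  isMarkOf⇒≡ {d} q = does≡true⇒ (toℕ q ≟ d)

  indexCode : Subset n → Vec ℕ n → ℕ → Vec ℕ (suc n)
  indexCode S f i = levelCode S f (isMarkOf ⌊ i /2⌋) (lookupOr 0 (tabulate (levels S f)) ⌊ i /2⌋)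

  module TightOn {S : Subset n} {f : Vec ℕ n} (T : IsTightOn S f) where
    open IsTightOn T

    levels-inside : ∀ {q} → q ∈ S → levels S f q ≡ lookup f q
    levels-inside {q} q∈S = cong (λ s → level (maxV f) s (lookup f q)) ([]=⇒lookup q∈S)

    levels<top : ∀ q → levels S f q < suc (suc (maxV f))
    levels<top q with lookup S q
    ... | inside  = s≤s (m≤n⇒m≤1+n (lookup≤maxV f q))
    ... | outside = ≤-refl

    levels-cover : ∀ j → Odd j → j < suc (suc (maxV f)) → ∃[ q ] levels S f q ≡ j
    levels-cover j odd-j j<top with covered j odd-j (Odd-<-2+ rank-odd odd-j j<top)
    ... | q , q∈S , fq≡j = q , trans (levels-inside q∈S) fq≡j

    unlevel-levels : ∀ q → unlevel (maxV f) (levels S f q) ≡ (lookup S q , lookup f q)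
    unlevel-levels q = unlevel-level (lookup S q) (lookup≤maxV f q) outside⇒0
      where
      outside⇒0 : lookup S q ≡ outside → lookup f q ≡ 0
      outside⇒0 Sq≡outside = vanishes q λ q∈S →
        contradiction (trans (sym Sq≡outside) ([]=⇒lookup q∈S)) λ ()

    module _ {P : Fin n → Bool} {x : ℕ} (M : IsMarking (levels S f) P x (suc (suc (maxV f)))) where
      open Marking M

      levelCode-isTightFun : IsTightFun (levelCode S f P x)
      levelCode-isTightFun = markCode-isTightFun (Odd⇒Odd-2+ rank-odd) levels-cover

      decodeLevels-levelCode : decodeLevels (levelCode S f P x) ≡ (S , f)
      decodeLevels-levelCode = cong₂ _,_ (tabulate-≗-lookup S (cong proj₁ ∘ decoded))
                                         (tabulate-≗-lookup f (cong proj₂ ∘ decoded))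
        where
        decoded : ∀ q → unlevel (maxV (levelCode S f P x) ∸ 2) (unmark (levelCode S f P x) q)
                        ≡ (lookup S q , lookup f q)
        decoded q = trans (cong₂ (λ m v → unlevel (m ∸ 2) v) maxV-markCode (unmark-markCode q))
                          (unlevel-levels q)

    obligation-isMarking : ∀ {O i} → (∀ q → q ∈ O → q ∈ S × lookup f q ≡ i) → Nonempty O →
                           IsMarking (levels S f) (lookup O) i (suc (suc (maxV f)))
    obligation-isMarking {O} O⊆S∩f⁻¹i (o , o∈O) = record
      { below  = levels<top
      ; keeps  = λ q Oq → let q∈S , fq≡i = O⊆S∩f⁻¹i q (lookup⇒[]= q O Oq)
                          in trans (levels-inside q∈S) fq≡i
      ; marked = o , []=⇒lookup o∈O
      }

    module _ {i : ℕ} (i/2<n : ⌊ i /2⌋ < n) where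
      private
        t : Fin n
        t = fromℕ< i/2<n

      index-isMarking : IsMarking (levels S f) (isMarkOf ⌊ i /2⌋)
                          (lookupOr 0 (tabulate (levels S f)) ⌊ i /2⌋) (suc (suc (maxV f)))
      index-isMarking = record
        { below  = levels<top
        ; keeps  = λ q marked → sym (begin
            lookupOr 0 table ⌊ i /2⌋  ≡⟨ cong (lookupOr 0 table) (sym (isMarkOf⇒≡ q marked)) ⟩
            lookupOr 0 table (toℕ q)  ≡⟨ lookupOr-toℕ 0 table q ⟩
            lookup table q            ≡⟨ lookup∘tabulate (levels S f) q ⟩
            levels S f q              ∎)
        ; marked = t , dec-true (toℕ t ≟ ⌊ i /2⌋) (toℕ-fromℕ< i/2<n)
        }
        where
        open ≡-Reasoning
        table : Vec ℕ n
        table = tabulate (levels S f)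

      markIndex-indexCode : markIndex (indexCode S f i) ≡ ⌊ i /2⌋
      markIndex-indexCode = trans (markIndex-markCode unique) (toℕ-fromℕ< i/2<n)
        where
        open Marking index-isMarking
        unique : ∀ q → isMarkOf ⌊ i /2⌋ q ≡ true → q ≡ t
        unique q marked = toℕ-injective (trans (isMarkOf⇒≡ q marked) (sym (toℕ-fromℕ< i/2<n)))

  indicator : Subset n → Fin (suc n) → ℕ
  indicator S zero    = 1
  indicator S (suc q) = if lookup S q then 1 else 0

  subsetCode : Subset n → Vec ℕ (suc n)
  subsetCode S = tabulate (indicator S)

  decodeSubset : Vec ℕ (suc n) → Subset n
  decodeSubset w = tabulate (λ q → does (lookup w (suc q) ≟ 1))

  subsetCode-isTightFun : ∀ S → IsTightFun (subsetCode S)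
  subsetCode-isTightFun S = tabulate-isTightFun (indicator S) (0 , refl) indicator≤1 covers
    where
    indicator≤1 : ∀ y → indicator S y ≤ 1
    indicator≤1 zero    = ≤-refl
    indicator≤1 (suc q) with lookup S q
    ... | true  = ≤-refl
    ... | false = z≤n
    covers : ∀ j → Odd j → j ≤ 1 → ∃[ y ] indicator S y ≡ j
    covers (suc zero)    _        _        = zero , refl
    covers zero          (_ , ()) _
    covers (suc (suc _)) _        (s≤s ())

  decodeSubset-subsetCode : ∀ S → decodeSubset (subsetCode S) ≡ S
  decodeSubset-subsetCode S = tabulate-≗-lookup S λ q →
    trans (cong (λ v → does (v ≟ 1)) (lookup∘tabulate (indicator S) (suc q))) (bit (lookup S q))
    where
    bit : ∀ s → does ((if s then 1 else 0) ≟ 1) ≡ s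
    bit true  = refl
    bit false = refl

-- Encoding the states of the Büchi automaton

≼-by-leftInverse : ∀ {A B : Set} {P : A → Set} {R : B → Set} (g : A → B) (h : B → A) →
                   (∀ x → P x → R (g x)) → (∀ x → P x → h (g x) ≡ x) → P ≼ R
≼-by-leftInverse g h g-into h∘g≡id = g , g-into , λ x y Px Py gx≡gy →
  trans (sym (h∘g≡id x Px)) (trans (cong h gx≡gy) (h∘g≡id y Py))

module _ (A : TELA) (inf : IsInfTELA A) where
  open TELA A
  open Construction A inf
  open Bound A inf 3 using (BoundCarrier; InBound)

  tight⇒IsTightOn : ∀ {S f μ} → Tight S f μ → IsTightOn S f
  tight⇒IsTightOn (_ , _ , rank-odd , covered , vanishes , _) = record
    { rank-odd = rank-odd ; covered = covered ; vanishes = vanishes }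

  encode : LevelM → Qraw → BoundCarrier
  encode μ₀ (inj₁ S) = zero , μ₀ , subsetCode S
  encode μ₀ (inj₂ (S , O , f , i , μ)) with nonempty? O
  ... | yes _ = suc zero , μ , obligationCode S O f i
  ... | no  _ = suc (suc zero) , μ , indexCode S f i

  rankedState : Subset n × Vec ℕ n → Subset n → ℕ → LevelM → Qraw
  rankedState (S , f) O i μ = inj₂ (S , O , f , i , μ)

  decode : BoundCarrier → Qraw
  decode (zero , _ , w)        = inj₁ (decodeSubset w)
  decode (suc zero , μ , w)    = rankedState (decodeLevels w) (tabulate (markedPositions w)) (lookup w zero) μ
  decode (suc (suc _) , μ , w) = rankedState (decodeLevels w) ∅ (2 * markIndex w) μ

  encode-inBound : ∀ μ₀ → IsLevelModel μ₀ → ∀ x → IsState x → InBound (encode μ₀ x)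
  encode-inBound μ₀ μ₀-model (inj₁ S) _ = μ₀-model , subsetCode-isTightFun S
  encode-inBound μ₀ _ (inj₂ (S , O , f , i , μ)) (_ , (even-i , i+2≤2n) , μ-model , tight , O⊆)
    with nonempty? O
  ... | yes nonempty = μ-model , levelCode-isTightFun (obligation-isMarking O⊆ nonempty)
    where open TightOn (tight⇒IsTightOn {S} {f} {μ} tight)
  ... | no  _        = μ-model , levelCode-isTightFun (index-isMarking (Even⇒⌊/2⌋< even-i i+2≤2n))
    where open TightOn (tight⇒IsTightOn {S} {f} {μ} tight)

  decode-encode : ∀ μ₀ x → IsState x → decode (encode μ₀ x) ≡ x
  decode-encode μ₀ (inj₁ S) _ = cong inj₁ (decodeSubset-subsetCode S)
  decode-encode μ₀ (inj₂ (S , O , f , i , μ)) (_ , (even-i , i+2≤2n) , _ , tight , O⊆)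
    with nonempty? O
  ... | yes nonempty =
    cong₂ (λ L O′ → rankedState L O′ i μ) (decodeLevels-levelCode M)
          (tabulate-≗-lookup O (Marking.markedPositions-markCode M))
    where
    open TightOn (tight⇒IsTightOn {S} {f} {μ} tight)
    M : IsMarking (levels S f) (lookup O) i (suc (suc (maxV f)))
    M = obligation-isMarking O⊆ nonempty
  ... | no  empty = begin
    rankedState (decodeLevels (indexCode S f i)) ∅ (2 * markIndex (indexCode S f i)) μ
      ≡⟨ cong₂ (λ L j → rankedState L ∅ (2 * j) μ)
               (decodeLevels-levelCode (index-isMarking i/2<n)) (markIndex-indexCode i/2<n) ⟩
    inj₂ (S , ∅ , f , 2 * ⌊ i /2⌋ , μ)
      ≡⟨ cong₂ (λ O′ j → inj₂ (S , O′ , f , j , μ)) (sym (Empty-unique empty)) (sym (Even⇒≡2*⌊/2⌋ even-i)) ⟩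
    inj₂ (S , O , f , i , μ) ∎
    where
    open ≡-Reasoning
    open TightOn (tight⇒IsTightOn {S} {f} {μ} tight)
    i/2<n : ⌊ i /2⌋ < n
    i/2<n = Even⇒⌊/2⌋< even-i i+2≤2n

  IsState≼InBound : MinNonempty A inf → IsState ≼ InBound
  IsState≼InBound (M₀ , M₀-min) =
    ≼-by-leftInverse {R = InBound} (encode μ₀) decode (encode-inBound μ₀ μ₀-model) (decode-encode μ₀)
    where
    μ₀ : LevelM
    μ₀ = replicate n M₀
    μ₀-model : IsLevelModel μ₀
    μ₀-model q = subst (IsMin negφ) (sym (lookup-replicate q M₀)) M₀-min

theorem2 : ∃[ C ] ((A : TELA) (inf : IsInfTELA A) → MinNonempty A inf →
             Construction.IsState A inf ≼ Bound.InBound A inf C)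
theorem2 = 3 , IsState≼InBound
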